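{- Let $k\ge2$ and $\sigma=-^k$ (all $k$ entries equal to $-$). If $\pi\in\mathcal P_n(\Sigma_\sigma)$, then $\hat\pi\in\mathcal C^\sigma_n$. Additionally, the converse holds if $n\not\equiv2\pmod4$: every $\pi\in\mathcal S_n$ with $\hat\pi\in\mathcal C^\sigma_n$ lies in $\mathcal P_n(\Sigma_\sigma)$.
   Context: Fix $\sigma=\sigma_0\dots\sigma_{k-1}\in\{+,-\}^k$; let $T^-_\sigma=\{t:\sigma_t=-\}$. Let $\mathcal W_k$ be the set of infinite words $s=s_1s_2\dots$ over $\{0,\dots,k-1\}$, $s_{[i,\infty)}=s_is_{i+1}\dots$. The order $\prec_\sigma$: for $s\ne t$, with $j$ the first index where $s_j\neq t_j$ and $c=|\{i<j:s_i\in T^-_\sigma\}|$, $s\prec_\sigma t$ iff ($c$ even and $s_j<t_j$) or ($c$ odd and $s_j>t_j$). $\Sigma_\sigma(s_1s_2\dots)=s_2s_3\dots$. $\mathcal W_{k,n}$ is the set of words $(s_1\dots s_n)^\infty$ with $s_1\dots s_n$ primitive (not a power of a shorter word). For $s\in\mathcal W_{k,n}$, $\Pi_\sigma(s)\in\mathcal S_n$ is the permutation with $\Pi_\sigma(s)_i<\Pi_\sigma(s)_j$ iff $s_{[i,\infty)}\prec_\sigma s_{[j,\infty)}$, and $\mathcal P_n(\Sigma_\sigma)=\{\Pi_\sigma(s):s\in\mathcal W_{k,n}\}$. For $\pi\in\mathcal S_n$, $\hat\pi$ is the cyclic permutation $(\pi_1,\dots,\pi_n)$ in cycle notation, i.e.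 $\hat\pi_{\pi_i}=\pi_{i+1}$ with $\pi_{n+1}=\pi_1$. A $\sigma$-segmentation of $\tau\in\mathcal S_n$ is $0=e_0\le e_1\le\dots\le e_k=n$ such that each $\tau_{e_t+1}\dots\tau_{e_{t+1}}$ is increasing if $\sigma_t=+$ and decreasing if $\sigma_t=-$. $\mathcal C^\sigma_n$ is the set of cyclic permutations (single $n$-cycles) in $\mathcal S_n$ admitting a $\sigma$-segmentation. -}

module Defs where

open import Data.Nat as ℕ using (ℕ; zero; suc; _+_; _%_; NonZero)
open import Data.Nat.DivMod using (m%n<n)
open import Data.Nat.Divisibility using (_∣_)
open import Data.Fin as Fin using (Fin; toℕ; fromℕ<; inject₁; fromℕ)
open import Data.Fin.Permutation using (Permutation′; _⟨$⟩ʳ_; _⟨$⟩ˡ_)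
open import Data.Vec using (Vec; lookup; replicate)
open import Data.Product using (Σ; ∃; _×_; _,_)
open import Data.Sum using (_⊎_)
open import Function using (_∘_; _⇔_)
open import Function.Base using (id)
open import Relation.Binary.PropositionalEquality using (_≡_)
open import Relation.Nullary using (¬_)

data Sign : Set where
  plus minus : Sign

allMinus : (k : ℕ) → Vec Sign k
allMinus k = replicate k minus

-- Infinite words over {0,…,k-1}; position m (0-based) holds the letter s_{m+1}.
Word : ℕ → Set
Word k = ℕ → Fin k

-- tail s_{[i+1,∞)} (0-based shift by i)
shift : ∀ {k} → Word k → ℕ → Word k
shift s i m = s (i + m)

isMinus : Sign → ℕ
isMinus plus  = 0
isMinus minus = 1

countMinus : ∀ {k} → Vec Sign k → Word k → ℕ → ℕ
countMinus σ s zero    = 0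
countMinus σ s (suc j) = countMinus σ s j + isMinus (lookup σ (s j))

_≺[_]_ : ∀ {k} → Word k → Vec Sign k → Word k → Set
s ≺[ σ ] t = Σ ℕ λ j →
  (∀ i → i ℕ.< j → s i ≡ t i) ×
  ((countMinus σ s j % 2 ≡ 0 × s j Fin.< t j) ⊎
   (countMinus σ s j % 2 ≡ 1 × t j Fin.< s j))

periodic : ∀ {k n} .{{_ : NonZero n}} → (Fin n → Fin k) → Word k
periodic {n = n} w m = w (fromℕ< (m%n<n m n))

IsProperPower : ∀ {k n} → (Fin n → Fin k) → Set
IsProperPower {k} {n} w = Σ ℕ λ d → Σ (Fin (suc d) → Fin k) λ u →
  suc d ∣ n × suc d ℕ.< n × (∀ (i : Fin n) → w i ≡ u (fromℕ< (m%n<n (toℕ i) (suc d))))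

Primitive : ∀ {k n} → (Fin n → Fin k) → Set
Primitive w = ¬ IsProperPower w

IsPatternOf : ∀ {k n} .{{_ : NonZero n}} → Vec Sign k → (Fin n → Fin k) → Permutation′ n → Set
IsPatternOf {n = n} σ w π = ∀ (i j : Fin n) →
  ((π ⟨$⟩ʳ i) Fin.< (π ⟨$⟩ʳ j)) ⇔ (shift (periodic w) (toℕ i) ≺[ σ ] shift (periodic w) (toℕ j))

InP : ∀ {n} .{{_ : NonZero n}} (k : ℕ) → Vec Sign k → Permutation′ n → Set
InP {n} k σ π = Σ (Fin n → Fin k) λ w → Primitive w × IsPatternOf σ w π

nextPos : ∀ {n} .{{_ : NonZero n}} → Fin n → Fin n
nextPos {n} i = fromℕ< (m%n<n (suc (toℕ i)) n)

-- π̂ = (π_1,…,π_n) in cycle notation:  π̂(π_i) = π_{i+1}, π_{n+1} = π_1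
hat : ∀ {n} .{{_ : NonZero n}} → Permutation′ n → Fin n → Fin n
hat π x = π ⟨$⟩ʳ nextPos (π ⟨$⟩ˡ x)

iter : ∀ {A : Set} → (A → A) → ℕ → A → A
iter f zero    x = x
iter f (suc m) x = f (iter f m x)

IsNCycle : ∀ {n} → (Fin n → Fin n) → Set
IsNCycle {n} τ = ∀ (i j : Fin n) → Σ ℕ λ m → iter τ m i ≡ j

Injective′ : ∀ {n} → (Fin n → Fin n) → Set
Injective′ {n} τ = ∀ (i j : Fin n) → τ i ≡ τ j → i ≡ j

Monotone : Sign → ∀ {n} → (Fin n → Fin n) → Fin n → Fin n → Set
Monotone plus  τ p q = τ p Fin.< τ q
Monotone minus τ p q = τ q Fin.< τ p

-- σ-segmentation 0 = e_0 ≤ e_1 ≤ … ≤ e_k = n of τ (one-line notation τ_1…τ_n):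
-- block t consists of (0-based) positions p with e_t ≤ p < e_{t+1}
Segmentation : ∀ {k n} → Vec Sign k → (Fin n → Fin n) → Set
Segmentation {k} {n} σ τ = Σ (Fin (suc k) → ℕ) λ e →
  e Fin.zero ≡ 0 × e (fromℕ k) ≡ n ×
  (∀ (t : Fin k) → e (inject₁ t) ℕ.≤ e (Fin.suc t)) ×
  (∀ (t : Fin k) (p q : Fin n) → e (inject₁ t) ℕ.≤ toℕ p → toℕ p ℕ.< toℕ q →
      toℕ q ℕ.< e (Fin.suc t) → Monotone (lookup σ t) τ p q)

InC : ∀ {k n} → Vec Sign k → (Fin n → Fin n) → Set
InC σ τ = Injective′ τ × IsNCycle τ × Segmentation σ τ

-- For σ = -^k the order ≺_σ is the alternating lexicographic order, and both directions
-- go through one notion: w is compatible with π when letters weakly increase with the rank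
-- π_i of their position and two positions carrying the same letter have successors in
-- reversed rank order. A pattern of Σ_σ gives a compatible word whose letters cut the ranks
-- into the decreasing blocks of a σ-segmentation of π̂; conversely the blocks of a
-- σ-segmentation of π̂ label the ranks compatibly. A compatible word realises π and is
-- primitive as soon as w^∞ has no period q ≢ 0 (mod n). An even period is excluded since
-- two reversals preserve order; an odd period q yields the even period 2q, still nonzero
-- modulo n because n ≢ 2 (mod 4).

module Submission where

open import Defs
open import Data.Nat using (ℕ; _≤_; _%_; NonZero)
open import Data.Fin.Permutation using (Permutation′)
open import Data.Product using (_×_)
open import Relation.Binary.PropositionalEquality using (_≢_)

open import Data.Nat using (zero; suc; pred; _+_; _*_; _∸_; _<_; z≤n; s≤s; z<s; _<?_; >-nonZero⁻¹)
open import Data.Nat.Properties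
open import Data.Nat.DivMod
open import Data.Nat.Divisibility using (_∣_; divides; m%n≡0⇒n∣m; n∣m⇒m%n≡0)
open import Data.Nat.Tactic.RingSolver using (solve-∀)
open import Data.Fin as Fin using (Fin; toℕ; inject₁; fromℕ)
import Data.Fin.Properties as Fin
open import Data.Fin.Permutation using (_⟨$⟩ʳ_; _⟨$⟩ˡ_; inverseˡ; inverseʳ)
open import Data.Vec using (lookup)
open import Data.Vec.Properties using (lookup-replicate)
open import Data.Product using (Σ; ∃; _,_; proj₁; proj₂)
open import Data.Sum using (_⊎_; inj₁; inj₂)
open import Data.Empty using (⊥; ⊥-elim)
open import Function using (_∘_; flip; _⇔_; mk⇔; Equivalence)
open import Relation.Nullary using (¬_; yes; no)
open import Relation.Binary.PropositionalEquality
open import Relation.Binary.Definitions using (Transitive; Tri; tri<; tri≈; tri>)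

-- The alternating lexicographic order

Alternating : ℕ → Set → Set → Set
Alternating j A B = (j % 2 ≡ 0 × A) ⊎ (j % 2 ≡ 1 × B)

alternating-suc : ∀ j {A B : Set} → Alternating j A B → Alternating (suc j) B A
alternating-pred : ∀ j {A B : Set} → Alternating (suc j) B A → Alternating j A B

alternating-suc zero    (inj₁ (_ , a)) = inj₂ (refl , a)
alternating-suc (suc j)                = alternating-pred j

alternating-pred zero    (inj₂ (_ , a)) = inj₁ (refl , a)
alternating-pred (suc j)                = alternating-suc j

tail : ∀ {k} → Word k → Word k
tail s = shift s 1

-- Every letter of σ = -^k reverses the comparison, so equal first letters swap the
-- roles of the two tails.
infix 4 _≺⁻_
data _≺⁻_ {k} : Word k → Word k → Set where
  head< : ∀ {s t} → s 0 Fin.< t 0 → s ≺⁻ t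
  head≡ : ∀ {s t} → s 0 ≡ t 0 → tail t ≺⁻ tail s → s ≺⁻ t

≺⁻-asym : ∀ {k} {s t : Word k} → s ≺⁻ t → ¬ t ≺⁻ s
≺⁻-asym (head< s<t) (head< t<s)   = <-asym s<t t<s
≺⁻-asym (head< s<t) (head≡ t≡s _) = <-irrefl (cong toℕ (sym t≡s)) s<t
≺⁻-asym (head≡ s≡t _) (head< t<s) = <-irrefl (cong toℕ (sym s≡t)) t<s
≺⁻-asym (head≡ _ r) (head≡ _ r′)  = ≺⁻-asym r′ r

≺⁻-irrefl : ∀ {k} {s : Word k} → ¬ s ≺⁻ s
≺⁻-irrefl r = ≺⁻-asym r r

≺⁻-resp : ∀ {k} {s s′ t t′ : Word k} → s ≗ s′ → t ≗ t′ → s ≺⁻ t → s′ ≺⁻ t′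
≺⁻-resp s≗s′ t≗t′ (head< l)   = head< (subst₂ Fin._<_ (s≗s′ 0) (t≗t′ 0) l)
≺⁻-resp s≗s′ t≗t′ (head≡ e r) =
  head≡ (trans (sym (s≗s′ 0)) (trans e (t≗t′ 0))) (≺⁻-resp (t≗t′ ∘ suc) (s≗s′ ∘ suc) r)

≺⁻-tail : ∀ {k} {s t : Word k} → s 0 ≡ t 0 → s ≺⁻ t → tail t ≺⁻ tail s
≺⁻-tail e (head< l)   = ⊥-elim (<-irrefl (cong toℕ e) l)
≺⁻-tail e (head≡ _ r) = r

FirstDifference : ∀ {k} → Word k → Word k → ℕ → Set
FirstDifference s t j = (∀ i → i < j → s i ≡ t i) × Alternating j (s j Fin.< t j) (t j Fin.< s j)

≺⁻⇒firstDifference : ∀ {k} {s t : Word k} → s ≺⁻ t → ∃ (FirstDifference s t)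
≺⁻⇒firstDifference (head< l) = 0 , (λ _ ()) , inj₁ (refl , l)
≺⁻⇒firstDifference {s = s} {t} (head≡ e r) with ≺⁻⇒firstDifference r
... | j , agree , differ = suc j , agree′ , alternating-suc j differ
  where
  agree′ : ∀ i → i < suc j → s i ≡ t i
  agree′ zero    _         = e
  agree′ (suc i) (s≤s i<j) = sym (agree i i<j)

firstDifference⇒≺⁻ : ∀ {k} {s t : Word k} j → FirstDifference s t j → s ≺⁻ t
firstDifference⇒≺⁻ zero    (_ , inj₁ (_ , l))   = head< l
firstDifference⇒≺⁻ (suc j) (agree , differ) =
  head≡ (agree 0 z<s)
    (firstDifference⇒≺⁻ j ((λ i i<j → sym (agree (suc i) (s≤s i<j))) , alternating-pred j differ))

countMinus-allMinus : ∀ {k} (s : Word k) j → countMinus (allMinus k) s j ≡ j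
countMinus-allMinus s zero    = refl
countMinus-allMinus s (suc j) =
  trans (cong₂ _+_ (countMinus-allMinus s j) (cong isMinus (lookup-replicate (s j) minus))) (+-comm j 1)

≺⁻⇔≺ : ∀ {k} {s t : Word k} → s ≺⁻ t ⇔ s ≺[ allMinus k ] t
≺⁻⇔≺ {k} {s} {t} = mk⇔ to from
  where
  differ-at : ℕ → ℕ → Set
  differ-at c j = Alternating c (s j Fin.< t j) (t j Fin.< s j)
  to : s ≺⁻ t → s ≺[ allMinus k ] t
  to r with ≺⁻⇒firstDifference r
  ... | j , agree , differ =
    j , agree , subst (λ c → differ-at c j) (sym (countMinus-allMinus s j)) differ
  from : s ≺[ allMinus k ] t → s ≺⁻ t
  from (j , agree , differ) =
    firstDifference⇒≺⁻ j (agree , subst (λ c → differ-at c j) (countMinus-allMinus s j) differ)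

-- Positions modulo n and the cycle π̂

module _ {n : ℕ} .{{_ : NonZero n}} where

  toℕ-mod : ∀ x → toℕ (x mod n) ≡ x % n
  toℕ-mod x = Fin.toℕ-fromℕ< (m%n<n x n)

  toℕ-mod-< : ∀ {x} → x < n → toℕ (x mod n) ≡ x
  toℕ-mod-< {x} x<n = trans (toℕ-mod x) (m<n⇒m%n≡m x<n)

  mod-toℕ : ∀ (i : Fin n) → toℕ i mod n ≡ i
  mod-toℕ i = Fin.toℕ-injective (toℕ-mod-< (Fin.toℕ<n i))

  mod-cong : ∀ {x y} → x % n ≡ y % n → x mod n ≡ y mod n
  mod-cong {x} {y} e = Fin.fromℕ<-cong (x % n) (y % n) e (m%n<n x n) (m%n<n y n)

  mod-injective : ∀ {x y} → x mod n ≡ y mod n → x % n ≡ y % n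
  mod-injective {x} {y} e = trans (sym (toℕ-mod x)) (trans (cong toℕ e) (toℕ-mod y))

  [m%n+k]%n≡[m+k]%n : ∀ x m → (x % n + m) % n ≡ (x + m) % n
  [m%n+k]%n≡[m+k]%n x m = begin
    (x % n + m) % n           ≡⟨ %-distribˡ-+ (x % n) m n ⟩
    (x % n % n + m % n) % n   ≡⟨ cong (λ a → (a + m % n) % n) (m%n%n≡m%n x n) ⟩
    (x % n + m % n) % n       ≡⟨ %-distribˡ-+ x m n ⟨
    (x + m) % n               ∎
    where open ≡-Reasoning

  [y+[n∸x]]%n≡0⇒x≡y : ∀ {x y} → x < n → y < n → (y + (n ∸ x)) % n ≡ 0 → x ≡ y
  [y+[n∸x]]%n≡0⇒x≡y {x} {y} x<n y<n q%n≡0 = begin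
    x                          ≡⟨ m<n⇒m%n≡m x<n ⟨
    x % n                      ≡⟨ cong (λ a → (a + x) % n) q%n≡0 ⟨
    ((y + (n ∸ x)) % n + x) % n ≡⟨ [m%n+k]%n≡[m+k]%n (y + (n ∸ x)) x ⟩
    (y + (n ∸ x) + x) % n      ≡⟨ cong (_% n) (+-assoc y (n ∸ x) x) ⟩
    (y + (n ∸ x + x)) % n      ≡⟨ cong (λ a → (y + a) % n) (m∸n+n≡m (<⇒≤ x<n)) ⟩
    (y + n) % n                ≡⟨ [m+n]%n≡m%n y n ⟩
    y % n                      ≡⟨ m<n⇒m%n≡m y<n ⟩
    y                          ∎
    where open ≡-Reasoning

  mod-periodic : ∀ x c → (x + c * n) mod n ≡ x mod n
  mod-periodic x c = mod-cong ([m+kn]%n≡m%n x c n)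

  nextPos-mod : ∀ x → nextPos (x mod n) ≡ suc x mod n
  nextPos-mod x = mod-cong (begin
    suc (toℕ (x mod n)) % n   ≡⟨ cong (λ a → suc a % n) (toℕ-mod x) ⟩
    suc (x % n) % n           ≡⟨ cong (_% n) (+-comm 1 (x % n)) ⟩
    (x % n + 1) % n           ≡⟨ [m%n+k]%n≡[m+k]%n x 1 ⟩
    (x + 1) % n               ≡⟨ cong (_% n) (+-comm x 1) ⟩
    suc x % n                 ∎)
    where open ≡-Reasoning

  -- Adding pred n undoes the successor modulo n.
  nextPos-injective : ∀ {i j : Fin n} → nextPos i ≡ nextPos j → i ≡ j
  nextPos-injective {i} {j} e = mod-toℕ-injective (begin
    toℕ i % n                           ≡⟨ undo (toℕ i) ⟨
    (suc (toℕ i) % n + pred n) % n      ≡⟨ cong (λ a → (a + pred n) % n) (mod-injective e) ⟩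
    (suc (toℕ j) % n + pred n) % n      ≡⟨ undo (toℕ j) ⟩
    toℕ j % n                           ∎)
    where
    open ≡-Reasoning
    undo : ∀ x → (suc x % n + pred n) % n ≡ x % n
    undo x = begin
      (suc x % n + pred n) % n   ≡⟨ [m%n+k]%n≡[m+k]%n (suc x) (pred n) ⟩
      (suc x + pred n) % n       ≡⟨ cong (_% n) (+-suc x (pred n)) ⟨
      (x + suc (pred n)) % n     ≡⟨ cong (λ a → (x + a) % n) (suc-pred n) ⟩
      (x + n) % n                ≡⟨ [m+n]%n≡m%n x n ⟩
      x % n                      ∎
    mod-toℕ-injective : toℕ i % n ≡ toℕ j % n → i ≡ j
    mod-toℕ-injective e′ = trans (sym (mod-toℕ i)) (trans (mod-cong e′) (mod-toℕ j))

module Cycle {n : ℕ} .{{_ : NonZero n}} (π : Permutation′ n) where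

  rank : ℕ → Fin n
  rank x = π ⟨$⟩ʳ (x mod n)

  ⟨$⟩ʳ-injective : ∀ {i j} → π ⟨$⟩ʳ i ≡ π ⟨$⟩ʳ j → i ≡ j
  ⟨$⟩ʳ-injective e = trans (sym (inverseˡ π)) (trans (cong (π ⟨$⟩ˡ_) e) (inverseˡ π))

  ⟨$⟩ˡ-injective : ∀ {i j} → π ⟨$⟩ˡ i ≡ π ⟨$⟩ˡ j → i ≡ j
  ⟨$⟩ˡ-injective e = trans (sym (inverseʳ π)) (trans (cong (π ⟨$⟩ʳ_) e) (inverseʳ π))

  rank-toℕ : ∀ (i : Fin n) → rank (toℕ i) ≡ π ⟨$⟩ʳ i
  rank-toℕ i = cong (π ⟨$⟩ʳ_) (mod-toℕ i)

  position : Fin n → ℕ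
  position r = toℕ (π ⟨$⟩ˡ r)

  rank-position : ∀ r → rank (position r) ≡ r
  rank-position r = trans (rank-toℕ (π ⟨$⟩ˡ r)) (inverseʳ π)

  rank-position-< : ∀ {r r′} → r Fin.< r′ → rank (position r) Fin.< rank (position r′)
  rank-position-< {r} {r′} = subst₂ Fin._<_ (sym (rank-position r)) (sym (rank-position r′))

  rank-periodic : ∀ x c → rank (x + c * n) ≡ rank x
  rank-periodic x c = cong (π ⟨$⟩ʳ_) (mod-periodic x c)

  rank-injective : ∀ {x y} → rank x ≡ rank y → x % n ≡ y % n
  rank-injective e = mod-injective (⟨$⟩ʳ-injective e)

  hat-rank : ∀ x → hat π (rank x) ≡ rank (suc x)
  hat-rank x = cong (π ⟨$⟩ʳ_) (trans (cong nextPos (inverseˡ π)) (nextPos-mod x))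

  iter-hat-rank : ∀ m x → iter (hat π) m (rank x) ≡ rank (m + x)
  iter-hat-rank zero    x = refl
  iter-hat-rank (suc m) x = trans (cong (hat π) (iter-hat-rank m x)) (hat-rank (m + x))

  hat-injective : Injective′ (hat π)
  hat-injective i j e = ⟨$⟩ˡ-injective (nextPos-injective (⟨$⟩ʳ-injective e))

  hat-isNCycle : IsNCycle (hat π)
  hat-isNCycle r r′ = b + (n ∸ a) , (begin
    iter (hat π) (b + (n ∸ a)) r              ≡⟨ cong (iter (hat π) (b + (n ∸ a))) (rank-position r) ⟨
    iter (hat π) (b + (n ∸ a)) (rank a)       ≡⟨ iter-hat-rank (b + (n ∸ a)) a ⟩
    rank (b + (n ∸ a) + a)                    ≡⟨ cong rank (+-assoc b (n ∸ a) a) ⟩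
    rank (b + ((n ∸ a) + a))                  ≡⟨ cong (λ m → rank (b + m)) (m∸n+n≡m a≤n) ⟩
    rank (b + n)                              ≡⟨ cong (λ m → rank (b + m)) (*-identityˡ n) ⟨
    rank (b + 1 * n)                          ≡⟨ rank-periodic b 1 ⟩
    rank b                                    ≡⟨ rank-position r′ ⟩
    r′                                        ∎)
    where
    open ≡-Reasoning
    a = position r
    b = position r′
    a≤n : a ≤ n
    a≤n = <⇒≤ (Fin.toℕ<n (π ⟨$⟩ˡ r))

-- Monotone sequences and blocks of a segmentation

transitive-chain : ∀ {A : Set} (_R_ : A → A → Set) → Transitive _R_ → (a : ℕ → A) →
  (∀ c → a c R a (suc c)) → ∀ m .{{_ : NonZero m}} → a 0 R a m
transitive-chain _R_ R-trans a step (suc zero)    = step 0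
transitive-chain _R_ R-trans a step (suc (suc m)) =
  R-trans {j = a (suc m)} (transitive-chain _R_ R-trans a step (suc m)) (step (suc m))

countBelow : (ℕ → ℕ) → ℕ → ℕ → ℕ
countBelow f t zero = 0
countBelow f t (suc m) with f m <? t
... | yes _ = suc (countBelow f t m)
... | no  _ = countBelow f t m

countBelow-≤ : ∀ f t m → countBelow f t m ≤ m
countBelow-≤ f t zero = z≤n
countBelow-≤ f t (suc m) with f m <? t
... | yes _ = s≤s (countBelow-≤ f t m)
... | no  _ = m≤n⇒m≤1+n (countBelow-≤ f t m)

countBelow-zero : ∀ f m → countBelow f 0 m ≡ 0
countBelow-zero f zero = refl
countBelow-zero f (suc m) with f m <? 0
... | no _ = countBelow-zero f m

countBelow-all : ∀ f t m → (∀ v → v < m → f v < t) → countBelow f t m ≡ m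
countBelow-all f t zero    _  = refl
countBelow-all f t (suc m) all with f m <? t
... | yes _   = cong suc (countBelow-all f t m (λ v v<m → all v (m<n⇒m<1+n v<m)))
... | no fm≮t = ⊥-elim (fm≮t (all m ≤-refl))

countBelow-mono : ∀ f {t t′} m → t ≤ t′ → countBelow f t m ≤ countBelow f t′ m
countBelow-mono f {t} {t′} zero t≤t′ = z≤n
countBelow-mono f {t} {t′} (suc m) t≤t′ with f m <? t | f m <? t′
... | yes _   | yes _    = s≤s (countBelow-mono f m t≤t′)
... | yes fm<t | no fm≮t′ = ⊥-elim (fm≮t′ (<-≤-trans fm<t t≤t′))
... | no _    | yes _    = m≤n⇒m≤1+n (countBelow-mono f m t≤t′)
... | no _    | no _     = countBelow-mono f m t≤t′

MonotoneBelow : ℕ → (ℕ → ℕ) → Set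
MonotoneBelow N f = ∀ {u v} → u ≤ v → v < N → f u ≤ f v

countBelow-threshold : ∀ {N} f t → MonotoneBelow N f → ∀ m → m ≤ N → ∀ {v} → v < m →
  v < countBelow f t m ⇔ f v < t
countBelow-threshold f t mono (suc m) m<N {v} v<m with f m <? t
... | yes fm<t = mk⇔
  (λ _ → ≤-<-trans (mono (≤-pred v<m) m<N) fm<t)
  (λ _ → subst (v <_) (cong suc (sym all-below)) v<m)
  where
  all-below : countBelow f t m ≡ m
  all-below = countBelow-all f t m (λ u u<m → ≤-<-trans (mono (<⇒≤ u<m) m<N) fm<t)
... | no fm≮t with m≤n⇒m<n∨m≡n (≤-pred v<m)
...   | inj₁ v<m′ = countBelow-threshold f t mono m (<⇒≤ m<N) v<m′
...   | inj₂ refl = mk⇔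
  (λ v<c → ⊥-elim (<-irrefl refl (<-≤-trans v<c (countBelow-≤ f t v))))
  (⊥-elim ∘ fm≮t)

blockOf : ∀ {k} (e : Fin (suc k) → ℕ) {v} → e Fin.zero ≤ v → v < e (fromℕ k) →
  Σ (Fin k) λ t → e (inject₁ t) ≤ v × v < e (Fin.suc t)
blockOf {zero}  e e0≤v v<e0 = ⊥-elim (<-irrefl refl (≤-<-trans e0≤v v<e0))
blockOf {suc k} e {v} e0≤v v<ek with v <? e (inject₁ (fromℕ k))
... | yes v<e = let t , spec = blockOf (e ∘ inject₁) e0≤v v<e in inject₁ t , spec
... | no v≮e  = fromℕ k , ≮⇒≥ v≮e , v<ek

stepwise-mono : ∀ {k} (e : Fin (suc k) → ℕ) → (∀ t → e (inject₁ t) ≤ e (Fin.suc t)) →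
  ∀ {i j} → i Fin.≤ j → e i ≤ e j
stepwise-mono e step {Fin.zero} {Fin.zero} _ = ≤-refl
stepwise-mono {suc k} e step {Fin.zero} {Fin.suc j} _ =
  ≤-trans (step Fin.zero) (stepwise-mono (e ∘ Fin.suc) (step ∘ Fin.suc) {Fin.zero} {j} z≤n)
stepwise-mono {suc k} e step {Fin.suc i} {Fin.suc j} (s≤s i≤j) =
  stepwise-mono (e ∘ Fin.suc) (step ∘ Fin.suc) i≤j

even⊎odd : ∀ q → (∃ λ h → q ≡ 2 * h) ⊎ (∃ λ h → q ≡ suc (2 * h))
even⊎odd zero = inj₁ (0 , refl)
even⊎odd (suc q) with even⊎odd q
... | inj₁ (h , refl) = inj₂ (h , refl)
... | inj₂ (h , refl) = inj₁ (suc h , cong suc (sym (+-suc h (h + 0))))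

-- Write 2q = c n. If c is even then n ∣ q; otherwise n = 2m is even (as c n is) and m
-- divides the odd number q, so n ≡ 2 (mod 4).
halve-divisor : ∀ {n q h} .{{_ : NonZero n}} → n % 4 ≢ 2 → q ≡ suc (2 * h) → n ∣ 2 * q → n ∣ q
halve-divisor {n} {q} {h} n%4≢2 q-odd (divides c 2q≡cn) with even⊎odd c
... | inj₁ (c′ , refl) = divides c′ (*-cancelˡ-≡ q (c′ * n) 2 (trans 2q≡cn (*-assoc 2 c′ n)))
... | inj₂ (c′ , refl) with even⊎odd n
...   | inj₂ (m , refl) = ⊥-elim (even≢odd q (m + c′ * suc (2 * m)) (trans 2q≡cn (odd*odd c′ m)))
  where
  odd*odd : ∀ c m → suc (2 * c) * suc (2 * m) ≡ suc (2 * (m + c * suc (2 * m)))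
  odd*odd = solve-∀
...   | inj₁ (m , refl) with even⊎odd m
...     | inj₁ (r , refl) = ⊥-elim (even≢odd (r + c′ * (2 * r)) h (trans (sym q-even) q-odd))
  where
  q-even : q ≡ 2 * (r + c′ * (2 * r))
  q-even = *-cancelˡ-≡ q _ 2 (trans 2q≡cn (odd*four c′ r))
    where
    odd*four : ∀ c r → suc (2 * c) * (2 * (2 * r)) ≡ 2 * (2 * (r + c * (2 * r)))
    odd*four = solve-∀
...     | inj₂ (r , refl) = ⊥-elim (n%4≢2 (trans (cong (_% 4) (twice-odd r)) ([m+kn]%n≡m%n 2 r 4)))
  where
  twice-odd : ∀ r → 2 * suc (2 * r) ≡ 2 + r * 4
  twice-odd = solve-∀

-- Compatible words

module Coding {n k : ℕ} .{{_ : NonZero n}} (π : Permutation′ n) (w : Fin n → Fin k) where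
  open Cycle π

  letter : ℕ → Fin k
  letter = periodic w

  suffix : ℕ → Word k
  suffix = shift letter

  suffix-head : ∀ x → suffix x 0 ≡ letter x
  suffix-head x = cong letter (+-identityʳ x)

  suffix-suc : ∀ x → tail (suffix x) ≗ suffix (suc x)
  suffix-suc x m = cong letter (+-suc x m)

  suffix-mod : ∀ x → suffix (toℕ (x mod n)) ≗ suffix x
  suffix-mod x m = cong w (mod-cong (trans (cong (λ a → (a + m) % n) (toℕ-mod x)) ([m%n+k]%n≡[m+k]%n x m)))

  letter-periodic : ∀ x c → letter (x + c * n) ≡ letter x
  letter-periodic x c = cong w (mod-periodic x c)

  record Compatible : Set where
    field
      letter-mono  : ∀ {x y} → rank x Fin.< rank y → letter x Fin.≤ letter y
      rank-reverse : ∀ {x y} → letter x ≡ letter y → rank x Fin.< rank y →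
                     rank (suc y) Fin.< rank (suc x)

  module _ (isPattern : IsPatternOf (allMinus k) w π) where

    rank<⇔suffix≺⁻ : ∀ x y → rank x Fin.< rank y ⇔ suffix x ≺⁻ suffix y
    rank<⇔suffix≺⁻ x y = mk⇔
      (≺⁻-resp (suffix-mod x) (suffix-mod y) ∘ Equivalence.from ≺⁻⇔≺ ∘ Equivalence.to (isPattern i j))
      (Equivalence.from (isPattern i j) ∘ Equivalence.to ≺⁻⇔≺ ∘
         ≺⁻-resp (sym ∘ suffix-mod x) (sym ∘ suffix-mod y))
      where
      i = x mod n
      j = y mod n

    pattern⇒compatible : Compatible
    pattern⇒compatible = record { letter-mono = letter-mono ; rank-reverse = rank-reverse }
      where
      letter-mono : ∀ {x y} → rank x Fin.< rank y → letter x Fin.≤ letter y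
      letter-mono {x} {y} rx<ry = ≮⇒≥ λ ly<lx →
        <-asym rx<ry (Equivalence.from (rank<⇔suffix≺⁻ y x)
          (head< (subst₂ Fin._<_ (sym (suffix-head y)) (sym (suffix-head x)) ly<lx)))
      rank-reverse : ∀ {x y} → letter x ≡ letter y → rank x Fin.< rank y → rank (suc y) Fin.< rank (suc x)
      rank-reverse {x} {y} lx≡ly rx<ry = Equivalence.from (rank<⇔suffix≺⁻ (suc y) (suc x))
        (≺⁻-resp (suffix-suc y) (suffix-suc x)
          (≺⁻-tail (trans (suffix-head x) (trans lx≡ly (sym (suffix-head y))))
            (Equivalence.to (rank<⇔suffix≺⁻ x y) rx<ry)))

  module _ (compatible : Compatible) where
    open Compatible compatible

    letterAt : Fin n → ℕ
    letterAt r = toℕ (letter (position r))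

    letterOfRank : ℕ → ℕ
    letterOfRank v = letterAt (v mod n)

    letterOfRank-toℕ : ∀ (r : Fin n) → letterOfRank (toℕ r) ≡ letterAt r
    letterOfRank-toℕ r = cong letterAt (mod-toℕ r)

    letterAt-mono : ∀ {r r′} → r Fin.< r′ → letterAt r ≤ letterAt r′
    letterAt-mono = letter-mono ∘ rank-position-<

    letterOfRank-mono : MonotoneBelow n letterOfRank
    letterOfRank-mono {u} {v} u≤v v<n with m≤n⇒m<n∨m≡n u≤v
    ... | inj₂ refl = ≤-refl
    ... | inj₁ u<v  =
      letterAt-mono (subst₂ _<_ (sym (toℕ-mod-< (<-trans u<v v<n))) (sym (toℕ-mod-< v<n)) u<v)

    e : Fin (suc k) → ℕ
    e t = countBelow letterOfRank (toℕ t) n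

    below-e⇔ : ∀ t (r : Fin n) → toℕ r < e t ⇔ letterAt r < toℕ t
    below-e⇔ t r = subst (λ a → toℕ r < e t ⇔ a < toℕ t) (letterOfRank-toℕ r)
      (countBelow-threshold letterOfRank (toℕ t) letterOfRank-mono n ≤-refl (Fin.toℕ<n r))

    sameLetter⇒hat-reverse : ∀ {r r′} → letterAt r ≡ letterAt r′ → r Fin.< r′ →
      hat π r′ Fin.< hat π r
    sameLetter⇒hat-reverse {r} {r′} same r<r′ =
      subst₂ Fin._<_ (hat-at r′) (hat-at r)
        (rank-reverse (Fin.toℕ-injective same) (rank-position-< r<r′))
      where
      hat-at : ∀ r → rank (suc (position r)) ≡ hat π r
      hat-at r = trans (sym (hat-rank (position r))) (cong (hat π) (rank-position r))

    compatible⇒segmentation : Segmentation (allMinus k) (hat π)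
    compatible⇒segmentation = e , e-zero , e-last , e-step , block-reverse
      where
      e-zero : e Fin.zero ≡ 0
      e-zero = countBelow-zero letterOfRank n
      e-last : e (fromℕ k) ≡ n
      e-last = trans (cong (λ t → countBelow letterOfRank t n) (Fin.toℕ-fromℕ k))
                     (countBelow-all letterOfRank k n (λ v _ → Fin.toℕ<n _))
      e-step : ∀ t → e (inject₁ t) ≤ e (Fin.suc t)
      e-step t = countBelow-mono letterOfRank n (≤-trans (≤-reflexive (Fin.toℕ-inject₁ t)) (n≤1+n (toℕ t)))
      block-reverse : ∀ (t : Fin k) (p q : Fin n) → e (inject₁ t) ≤ toℕ p → toℕ p < toℕ q →
        toℕ q < e (Fin.suc t) → Monotone (lookup (allMinus k) t) (hat π) p q
      block-reverse t p q ep≤p p<q q<et =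
        subst (λ s → Monotone s (hat π) p q) (sym (lookup-replicate t minus))
          (sameLetter⇒hat-reverse (≤-antisym (letterAt-mono p<q) (≤-trans q≤t t≤p)) p<q)
        where
        q≤t : letterAt q ≤ toℕ t
        q≤t = ≤-pred (Equivalence.to (below-e⇔ (Fin.suc t) q) q<et)
        t≤p : toℕ t ≤ letterAt p
        t≤p = ≮⇒≥ λ p<t → <⇒≱ (Equivalence.from (below-e⇔ (inject₁ t) p)
                (subst (letterAt p <_) (sym (Fin.toℕ-inject₁ t)) p<t)) ep≤p

  module _ (compatible : Compatible) (n%4≢2 : n % 4 ≢ 2) where
    open Compatible compatible

    reverse-step : ∀ {x y} → suffix x ≗ suffix y → rank x Fin.< rank y → rank (suc y) Fin.< rank (suc x)
    reverse-step {x} {y} agree = rank-reverse (trans (sym (suffix-head x)) (trans (agree 0) (suffix-head y)))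

    agree-suc : ∀ {x y} → suffix x ≗ suffix y → suffix (suc x) ≗ suffix (suc y)
    agree-suc {x} {y} agree m = trans (sym (suffix-suc x m)) (trans (agree (suc m)) (suffix-suc y m))

    agree-+ : ∀ c {x y} → suffix x ≗ suffix y → suffix (c + x) ≗ suffix (c + y)
    agree-+ zero    agree = agree
    agree-+ (suc c) agree = agree-suc (agree-+ c agree)

    reverse-twice : ∀ {x y} → suffix x ≗ suffix y → rank x Fin.< rank y → rank (2 + x) Fin.< rank (2 + y)
    reverse-twice agree l = reverse-step (sym ∘ agree-suc agree) (reverse-step agree l)

    reverse-even : ∀ c {x y} → suffix x ≗ suffix y → rank x Fin.< rank y →
      rank (2 * c + x) Fin.< rank (2 * c + y)
    reverse-even zero    agree l = l
    reverse-even (suc c) {x} {y} agree l =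
      subst₂ Fin._<_ (cong (rank ∘ (_+ x)) (sym (*-suc 2 c))) (cong (rank ∘ (_+ y)) (sym (*-suc 2 c)))
        (reverse-twice (agree-+ (2 * c) agree) (reverse-even c agree l))

    Period : ℕ → Set
    Period q = suffix q ≗ suffix 0

    period-agree : ∀ {q} → Period q → ∀ z → suffix z ≗ suffix (q + z)
    period-agree {q} per z m = trans (sym (per (z + m))) (cong letter (sym (+-assoc q z m)))

    period-double : ∀ {q} → Period q → Period (2 * q)
    period-double {q} per m = begin
      letter (2 * q + m)      ≡⟨ cong (λ a → letter (a + m)) (cong (q +_) (+-identityʳ q)) ⟩
      letter (q + q + m)      ≡⟨ cong letter (+-assoc q q m) ⟩
      letter (q + (q + m))    ≡⟨ per (q + m) ⟩
      letter (q + m)          ≡⟨ per m ⟩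
      letter m                ∎
      where open ≡-Reasoning

    -- With an even period Q, two steps of rank-reverse show that the ranks of 0, Q, 2Q, …
    -- are strictly monotone, which is impossible since nQ ≡ 0 modulo n.
    no-even-period : ∀ h → Period (2 * h) → (2 * h) % n ≢ 0 → ⊥
    no-even-period h per Q%n≢0 = contradiction (Fin.<-cmp (a 0) (a 1))
      where
      Q = 2 * h
      a : ℕ → Fin n
      a c = rank (c * Q)
      a-periodic : a n ≡ a 0
      a-periodic = trans (cong rank (*-comm n Q)) (rank-periodic 0 Q)
      ascending : a 0 Fin.< a 1 → ∀ c → a c Fin.< a (suc c)
      ascending l zero    = l
      ascending l (suc c) = reverse-even h (period-agree per (c * Q)) (ascending l c)
      descending : a 1 Fin.< a 0 → ∀ c → a (suc c) Fin.< a c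
      descending l zero    = l
      descending l (suc c) = reverse-even h (sym ∘ period-agree per (c * Q)) (descending l c)
      contradiction : Tri (a 0 Fin.< a 1) (a 0 ≡ a 1) (a 1 Fin.< a 0) → ⊥
      contradiction (tri< a₀<a₁ _ _) =
        <-irrefl (cong toℕ (sym a-periodic)) (transitive-chain Fin._<_ Fin.<-trans a (ascending a₀<a₁) n)
      contradiction (tri> _ _ a₁<a₀) =
        <-irrefl (cong toℕ a-periodic) (transitive-chain (flip Fin._<_) (flip Fin.<-trans) a (descending a₁<a₀) n)
      contradiction (tri≈ _ a₀≡a₁ _) = Q%n≢0 (begin
        Q % n          ≡⟨ cong (_% n) (+-identityʳ Q) ⟨
        (Q + 0) % n    ≡⟨ rank-injective a₀≡a₁ ⟨
        0 % n          ≡⟨ m<n⇒m%n≡m (>-nonZero⁻¹ n) ⟩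
        0              ∎)
        where open ≡-Reasoning

    no-period : ∀ {q} → Period q → q % n ≢ 0 → ⊥
    no-period {q} per q%n≢0 with even⊎odd q
    ... | inj₁ (h , refl) = no-even-period h per q%n≢0
    ... | inj₂ (h , q-odd) = no-even-period q (period-double {q} per) λ 2q%n≡0 →
      q%n≢0 (n∣m⇒m%n≡0 q n (halve-divisor {h = h} n%4≢2 q-odd (m%n≡0⇒n∣m (2 * q) n 2q%n≡0)))

    agree-periodic : ∀ {x y} → (∀ t → t < n → suffix x t ≡ suffix y t) → suffix x ≗ suffix y
    agree-periodic {x} {y} agree t = begin
      letter (x + t)                        ≡⟨ cong letter (reduce x) ⟩
      letter (x + t % n + (t / n) * n)      ≡⟨ letter-periodic (x + t % n) (t / n) ⟩
      letter (x + t % n)                    ≡⟨ agree (t % n) (m%n<n t n) ⟩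
      letter (y + t % n)                    ≡⟨ letter-periodic (y + t % n) (t / n) ⟨
      letter (y + t % n + (t / n) * n)      ≡⟨ cong letter (reduce y) ⟨
      letter (y + t)                        ∎
      where
      open ≡-Reasoning
      reduce : ∀ a → a + t ≡ a + t % n + (t / n) * n
      reduce a = trans (cong (a +_) (m≡m%n+[m/n]*n t n)) (sym (+-assoc a (t % n) _))

    agree⇒period : ∀ {x y} → x ≤ n → suffix x ≗ suffix y → Period (y + (n ∸ x))
    agree⇒period {x} {y} x≤n agree z = begin
      letter (y + (n ∸ x) + z)     ≡⟨ cong letter (+-assoc y (n ∸ x) z) ⟩
      letter (y + (n ∸ x + z))     ≡⟨ agree (n ∸ x + z) ⟨
      letter (x + (n ∸ x + z))     ≡⟨ cong letter (+-assoc x (n ∸ x) z) ⟨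
      letter (x + (n ∸ x) + z)     ≡⟨ cong (λ a → letter (a + z)) (m+[n∸m]≡n x≤n) ⟩
      letter (n + z)               ≡⟨ cong letter (+-comm n z) ⟩
      letter (z + n)               ≡⟨ cong (λ a → letter (z + a)) (*-identityˡ n) ⟨
      letter (z + 1 * n)           ≡⟨ letter-periodic z 1 ⟩
      letter z                     ∎
      where open ≡-Reasoning

    agree⇒≡ : ∀ {x y} → x < n → y < n → suffix x ≗ suffix y → x ≡ y
    agree⇒≡ {x} {y} x<n y<n agree with x ≟ y
    ... | yes x≡y = x≡y
    ... | no  x≢y = ⊥-elim (no-period (agree⇒period (<⇒≤ x<n) agree) (x≢y ∘ [y+[n∸x]]%n≡0⇒x≡y x<n y<n))

    rank<⇒suffix≺⁻ : ∀ F {x y} → rank x Fin.< rank y →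
      suffix x ≺⁻ suffix y ⊎ (∀ t → t < F → suffix x t ≡ suffix y t)
    rank<⇒suffix≺⁻ zero    rx<ry = inj₂ (λ _ ())
    rank<⇒suffix≺⁻ (suc F) {x} {y} rx<ry with Fin.<-cmp (suffix x 0) (suffix y 0)
    ... | tri< hx<hy _ _ = inj₁ (head< hx<hy)
    ... | tri> _ _ hy<hx =
      ⊥-elim (<⇒≱ hy<hx (subst₂ Fin._≤_ (sym (suffix-head x)) (sym (suffix-head y)) (letter-mono rx<ry)))
    ... | tri≈ _ hx≡hy _
      with rank<⇒suffix≺⁻ F (rank-reverse (trans (sym (suffix-head x)) (trans hx≡hy (suffix-head y))) rx<ry)
    ...   | inj₁ r     = inj₁ (head≡ hx≡hy (≺⁻-resp (sym ∘ suffix-suc y) (sym ∘ suffix-suc x) r))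
    ...   | inj₂ agree = inj₂ agree′
      where
      agree′ : ∀ t → t < suc F → suffix x t ≡ suffix y t
      agree′ zero    _         = hx≡hy
      agree′ (suc t) (s≤s t<F) = trans (suffix-suc x t) (trans (sym (agree t t<F)) (sym (suffix-suc y t)))

    compatible⇒isPattern : IsPatternOf (allMinus k) w π
    compatible⇒isPattern i j =
      mk⇔ (Equivalence.to ≺⁻⇔≺ ∘ ordered i j) (reflect ∘ Equivalence.from ≺⁻⇔≺)
      where
      ordered : ∀ i j → π ⟨$⟩ʳ i Fin.< π ⟨$⟩ʳ j → suffix (toℕ i) ≺⁻ suffix (toℕ j)
      ordered i j πi<πj
        with rank<⇒suffix≺⁻ n (subst₂ Fin._<_ (sym (rank-toℕ i)) (sym (rank-toℕ j)) πi<πj)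
      ... | inj₁ r     = r
      ... | inj₂ agree = ⊥-elim (Fin.<-irrefl (cong (π ⟨$⟩ʳ_) i≡j) πi<πj)
        where
        i≡j : i ≡ j
        i≡j = Fin.toℕ-injective (agree⇒≡ (Fin.toℕ<n i) (Fin.toℕ<n j) (agree-periodic agree))
      reflect : suffix (toℕ i) ≺⁻ suffix (toℕ j) → π ⟨$⟩ʳ i Fin.< π ⟨$⟩ʳ j
      reflect r with Fin.<-cmp (π ⟨$⟩ʳ i) (π ⟨$⟩ʳ j)
      ... | tri< πi<πj _ _ = πi<πj
      ... | tri> _ _ πj<πi = ⊥-elim (≺⁻-asym r (ordered j i πj<πi))
      ... | tri≈ _ πi≡πj _ with ⟨$⟩ʳ-injective πi≡πj
      ...   | refl = ⊥-elim (≺⁻-irrefl r)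

    compatible⇒primitive : Primitive w
    compatible⇒primitive (d , u , d+1∣n , d+1<n , w≡u) = no-period per d+1%n≢0
      where
      letter-power : ∀ x → letter x ≡ u (x mod suc d)
      letter-power x = trans (w≡u (x mod n)) (cong u (mod-cong {x = toℕ (x mod n)} {y = x} (begin
        toℕ (x mod n) % suc d   ≡⟨ cong (_% suc d) (toℕ-mod x) ⟩
        x % n % suc d           ≡⟨ m∣n⇒o%n%m≡o%m (suc d) n x d+1∣n ⟩
        x % suc d               ∎)))
        where open ≡-Reasoning
      per : Period (suc d)
      per z = begin
        letter (suc d + z)          ≡⟨ letter-power (suc d + z) ⟩
        u ((suc d + z) mod suc d)   ≡⟨ cong u (mod-cong {x = suc d + z} {y = z} (begin
          (suc d + z) % suc d          ≡⟨ cong (_% suc d) (+-comm (suc d) z) ⟩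
          (z + suc d) % suc d          ≡⟨ [m+n]%n≡m%n z (suc d) ⟩
          z % suc d                    ∎)) ⟩
        u (z mod suc d)             ≡⟨ letter-power z ⟨
        letter z                    ∎
        where open ≡-Reasoning
      d+1%n≢0 : suc d % n ≢ 0
      d+1%n≢0 d+1%n≡0 with trans (sym (m<n⇒m%n≡m d+1<n)) d+1%n≡0
      ... | ()

module _ {n k : ℕ} .{{_ : NonZero n}} (π : Permutation′ n) where
  open Cycle π

  segmentation⇒compatible : Segmentation (allMinus k) (hat π) → Σ (Fin n → Fin k) (Coding.Compatible π)
  segmentation⇒compatible (e , e-zero , e-last , e-step , block-reverse) =
    block ∘ (π ⟨$⟩ʳ_) , record { letter-mono = block-mono ; rank-reverse = rank-reverse }
    where
    in-block : ∀ (r : Fin n) → Σ (Fin k) λ t → e (inject₁ t) ≤ toℕ r × toℕ r < e (Fin.suc t)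
    in-block r =
      blockOf e (subst (_≤ toℕ r) (sym e-zero) z≤n) (subst (toℕ r <_) (sym e-last) (Fin.toℕ<n r))
    block : Fin n → Fin k
    block r = proj₁ (in-block r)
    block-start : ∀ r → e (inject₁ (block r)) ≤ toℕ r
    block-start r = proj₁ (proj₂ (in-block r))
    block-end : ∀ r → toℕ r < e (Fin.suc (block r))
    block-end r = proj₂ (proj₂ (in-block r))
    block-mono : ∀ {r r′} → r Fin.< r′ → block r Fin.≤ block r′
    block-mono {r} {r′} r<r′ = ≮⇒≥ λ b′<b → <-asym r<r′ (begin-strict
      toℕ r′                    <⟨ block-end r′ ⟩
      e (Fin.suc (block r′))    ≤⟨ stepwise-mono e e-step
                                     (subst (suc (toℕ (block r′)) ≤_) (sym (Fin.toℕ-inject₁ (block r))) b′<b) ⟩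
      e (inject₁ (block r))     ≤⟨ block-start r ⟩
      toℕ r                     ∎)
      where open ≤-Reasoning
    rank-reverse : ∀ {x y} → block (rank x) ≡ block (rank y) → rank x Fin.< rank y →
      rank (suc y) Fin.< rank (suc x)
    rank-reverse {x} {y} same rx<ry = subst₂ Fin._<_ (hat-rank y) (hat-rank x)
      (subst (λ s → Monotone s (hat π) (rank x) (rank y)) (lookup-replicate (block (rank x)) minus)
        (block-reverse (block (rank x)) (rank x) (rank y) (block-start (rank x)) rx<ry
          (subst (λ b → toℕ (rank y) < e (Fin.suc b)) (sym same) (block-end (rank y)))))

proposition2p6 : (k : ℕ) → 2 ≤ k → (n : ℕ) → .{{_ : NonZero n}} →
    ((π : Permutation′ n) → InP k (allMinus k) π → InC (allMinus k) (hat π)) ×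
    (n % 4 ≢ 2 → (π : Permutation′ n) → InC (allMinus k) (hat π) → InP k (allMinus k) π)
proposition2p6 k _ n = forward , backward
  where
  forward : (π : Permutation′ n) → InP k (allMinus k) π → InC (allMinus k) (hat π)
  forward π (w , _ , isPattern) =
    Cycle.hat-injective π , Cycle.hat-isNCycle π ,
    Coding.compatible⇒segmentation π w (Coding.pattern⇒compatible π w isPattern)
  backward : n % 4 ≢ 2 → (π : Permutation′ n) → InC (allMinus k) (hat π) → InP k (allMinus k) π
  backward n%4≢2 π (_ , _ , segmentation) with segmentation⇒compatible π segmentation
  ... | w , compatible =
    w , Coding.compatible⇒primitive π w compatible n%4≢2 , Coding.compatible⇒isPattern π w compatible n%4≢2
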